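{- Let $d\ge 2$ and define the sequences $(a_k)_{k\ge0}$, $(b_k)_{k\ge 0}$ by $a_0=1$, $b_0=2^{d-2}+1$, and for every $k\ge 0$, $a_{k+1}$ (resp. $b_{k+1}$) is the minimum of $|\partial X_1\cap Q_1|+|\partial X_2\cap Q_2|$ over all even sets $X_1\subseteq Q_1$ and $X_2\subseteq Q_2$ with $|X_1|+|X_2|=a_k$ (resp. $|X_1|+|X_2|=b_k$). Then $a_{d-2}=2^{d-2}$ and $b_{d-2}=2^{d-1}$.
   Context: $\mathbb{Q}^d$ is the hypercube graph with vertex set $\{1,2\}^d$, two vertices adjacent iff they differ in exactly one coordinate. $Q_1$ (resp. $Q_2$) is the set of vertices of $\mathbb{Q}^d$ whose last coordinate equals $1$ (resp. $2$). For a vertex set $A$, $\partial A$ is the set of vertices of $\mathbb{Q}^d$ at graph distance exactly $1$ from $A$. A vertex is even if the sum of its coordinates is even; a set is even if all its vertices are even. -}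

module Defs where

open import Data.Bool using (Bool; true; false; not; _∧_; if_then_else_)
open import Data.Nat using (ℕ; zero; suc; _+_; _%_; _≡ᵇ_; _≤_)
open import Data.List using (List; []; _∷_; _++_; map)
open import Data.Bool.ListAction using (any)
open import Data.Vec using (Vec; []; _∷_)
open import Data.Product using (Σ; _×_; _,_; ∃-syntax)
open import Relation.Binary.PropositionalEquality using (_≡_)

-- Vertices of the hypercube {1,2}^d, encoded as Bool vectors:
-- false ↦ coordinate value 1, true ↦ coordinate value 2.
Vertex : ℕ → Set
Vertex d = Vec Bool d

coordVal : Bool → ℕ
coordVal false = 1
coordVal true  = 2

coordSum : ∀ {d} → Vertex d → ℕ
coordSum []       = 0
coordSum (x ∷ xs) = coordVal x + coordSum xs

isEven : ∀ {d} → Vertex d → Bool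
isEven v = coordSum v % 2 ≡ᵇ 0

-- last coordinate (d = 0 never used; d ≥ 2 in the theorem)
lastC : ∀ {d} → Vertex d → Bool
lastC []           = false
lastC (x ∷ [])     = x
lastC (x ∷ y ∷ xs) = lastC (y ∷ xs)

inQ₁ : ∀ {d} → Vertex d → Bool
inQ₁ v = not (lastC v)

inQ₂ : ∀ {d} → Vertex d → Bool
inQ₂ v = lastC v

allV : (d : ℕ) → List (Vertex d)
allV zero    = [] ∷ []
allV (suc d) = map (false ∷_) (allV d) ++ map (true ∷_) (allV d)

hamming : ∀ {d} → Vertex d → Vertex d → ℕ
hamming []       []       = 0
hamming (x ∷ xs) (y ∷ ys) = (if eqB x y then 0 else 1) + hamming xs ys
  where
  eqB : Bool → Bool → Bool
  eqB true  true  = true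
  eqB false false = true
  eqB _     _     = false

adjacent : ∀ {d} → Vertex d → Vertex d → Bool
adjacent u v = hamming u v ≡ᵇ 1

VSet : ℕ → Set
VSet d = Vertex d → Bool

countL : ∀ {A : Set} → (A → Bool) → List A → ℕ
countL p []       = 0
countL p (x ∷ xs) = (if p x then 1 else 0) + countL p xs

card : ∀ {d} → VSet d → ℕ
card {d} A = countL A (allV d)

boundary : ∀ {d} → VSet d → VSet d
boundary {d} A v = not (A v) ∧ any (λ u → A u ∧ adjacent u v) (allV d)

_∩_ : ∀ {d} → VSet d → VSet d → VSet d
(A ∩ B) v = A v ∧ B v

_⊆_ : ∀ {d} → VSet d → VSet d → Set
_⊆_ {d} A B = ∀ (v : Vertex d) → A v ≡ true → B v ≡ true

EvenSet : ∀ {d} → VSet d → Set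
EvenSet {d} A = ∀ (v : Vertex d) → A v ≡ true → isEven v ≡ true

Admissible : (d n : ℕ) → VSet d → VSet d → Set
Admissible d n X₁ X₂ =
  (X₁ ⊆ inQ₁) × (X₂ ⊆ inQ₂) × EvenSet X₁ × EvenSet X₂ × (card X₁ + card X₂ ≡ n)

cost : ∀ {d} → VSet d → VSet d → ℕ
cost X₁ X₂ = card (boundary X₁ ∩ inQ₁) + card (boundary X₂ ∩ inQ₂)

IsMinCost : (d n m : ℕ) → Set
IsMinCost d n m =
  (∃[ X₁ ] ∃[ X₂ ] (Admissible d n X₁ X₂ × cost X₁ X₂ ≡ m)) ×
  (∀ X₁ X₂ → Admissible d n X₁ X₂ → m ≤ cost X₁ X₂)

{-# OPTIONS --safe #-}
-- An even set X in the layer Q_c (last coordinate c) of Q^(m+2) is determined by its trace Y on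
-- Q^m: over each w ∈ Q^m exactly one of the two vertices (x, w, c) is even, and the odd vertices
-- of Q_c adjacent to X are exactly those lying over the closed neighbourhood N[Y].  Hence a_{k+1}
-- (resp. b_{k+1}) is the least value of |N[Y₁]| + |N[Y₂]| over pairs of subsets of Q^m of total
-- size a_k (resp. b_k).  A Harper-type vertex-isoperimetric inequality for pairs, proved by down-
-- and shift-compressions and induction on the dimension, shows that this minimum is attained by a
-- Hamming ball paired with the empty set (resp. by Q^m paired with a ball).  So a_k is the size of
-- the ball of radius k and b_k − 2^m as well, and the ball of radius m is all of Q^m.
module Submission where

open import Defs
open import Data.Bool using (Bool; true; false; not; _∧_; _∨_; if_then_else_)
open import Data.Bool.ListAction using (any; or)
open import Data.Bool.Properties
  using ( not-involutive; not-injective; ¬-not; not-¬; T-≡; ⇔→≡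
        ; ∨-zeroʳ; ∧-zeroʳ; ∧-identityʳ; ∧-conicalˡ; ∧-conicalʳ)
  renaming (_≟_ to _≟ᵇ_)
open import Data.Empty using (⊥; ⊥-elim)
open import Data.Fin using (Fin; zero; suc; inject₁)
open import Data.Fin.Properties using (any?) renaming (_≟_ to _≟ᶠ_)
open import Data.List using ([]; _∷_; _++_; map)
open import Data.List.Membership.Propositional using (_∈_; lose)
open import Data.List.Membership.Propositional.Properties using (∈-map⁺; ∈-++⁺ˡ; ∈-++⁺ʳ)
open import Data.List.Properties using (map-cong)
open import Data.List.Relation.Unary.Any using (here; satisfied)
open import Data.List.Relation.Unary.Any.Properties using (any⁺; any⁻)
open import Data.Nat using (ℕ; zero; suc; _+_; _*_; _∸_; _^_; _%_; _≤_; _<_; z≤n; s≤s; z<s; _≤?_; _≡ᵇ_; _<ᵇ_)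
open import Data.Nat.DivMod using ([m+n]%n≡m%n)
open import Data.Nat.Induction using (<-wellFounded)
open import Data.Nat.Properties
open import Algebra.Properties.CommutativeSemigroup +-commutativeSemigroup using (interchange)
open import Data.Product using (_×_; _,_; ∃-syntax; proj₂)
open import Data.Sum using (_⊎_; inj₁; inj₂; [_,_]′)
open import Data.Vec using ([]; _∷_; _∷ʳ_; lookup; updateAt; init)
open import Data.Vec.Properties
  using ( ∷-injective; init-∷ʳ; lookup∘updateAt; lookup∘updateAt′; updateAt-updateAt; updateAt-cong
        ; updateAt-cong-local; updateAt-id; updateAt-id-local; updateAt-commutes)
open import Function using (_∘_; id; const; Equivalence; mk⇔)
open import Induction.WellFounded using (Acc; acc)
open import Relation.Binary.PropositionalEquality
open import Relation.Nullary using (¬_; Dec; yes; no; contradiction)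
open import Relation.Nullary.Decidable using (map′; _⊎-dec_; _×-dec_)

private variable m : ℕ

flipAt : Fin m → Vertex m → Vertex m
flipAt k v = updateAt v k not

flipAt-involutive : ∀ (k : Fin m) v → flipAt k (flipAt k v) ≡ v
flipAt-involutive k v = begin
  updateAt (updateAt v k not) k not ≡⟨ updateAt-updateAt k v ⟩
  updateAt v k (not ∘ not)          ≡⟨ updateAt-cong k not-involutive v ⟩
  updateAt v k id                   ≡⟨ updateAt-id k v ⟩
  v                                 ∎
  where open ≡-Reasoning

flipAt-comm : ∀ (k l : Fin m) v → flipAt k (flipAt l v) ≡ flipAt l (flipAt k v)
flipAt-comm k l v with k ≟ᶠ l
... | yes refl = refl
... | no k≢l   = updateAt-commutes k l k≢l v

lookup-flipAt : ∀ (k : Fin m) v → lookup (flipAt k v) k ≡ not (lookup v k)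
lookup-flipAt k v = lookup∘updateAt k v

lookup-flipAt′ : ∀ (k l : Fin m) v → k ≢ l → lookup (flipAt l v) k ≡ lookup v k
lookup-flipAt′ k l v k≢l = lookup∘updateAt′ k l k≢l v

hamming-refl : (v : Vertex m) → hamming v v ≡ 0
hamming-refl []          = refl
hamming-refl (false ∷ v) = hamming-refl v
hamming-refl (true ∷ v)  = hamming-refl v

hamming≡0⇒≡ : (u v : Vertex m) → hamming u v ≡ 0 → u ≡ v
hamming≡0⇒≡ []          []          _ = refl
hamming≡0⇒≡ (false ∷ u) (false ∷ v) h = cong (false ∷_) (hamming≡0⇒≡ u v h)
hamming≡0⇒≡ (true ∷ u)  (true ∷ v)  h = cong (true ∷_) (hamming≡0⇒≡ u v h)

hamming≡1⇒flipAt : (u v : Vertex m) → hamming u v ≡ 1 → ∃[ k ] u ≡ flipAt k v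
hamming≡1⇒flipAt []          []          ()
hamming≡1⇒flipAt (false ∷ u) (true ∷ v)  h = zero , cong (false ∷_) (hamming≡0⇒≡ u v (suc-injective h))
hamming≡1⇒flipAt (true ∷ u)  (false ∷ v) h = zero , cong (true ∷_) (hamming≡0⇒≡ u v (suc-injective h))
hamming≡1⇒flipAt (false ∷ u) (false ∷ v) h =
  let k , u≡ = hamming≡1⇒flipAt u v h in suc k , cong (false ∷_) u≡
hamming≡1⇒flipAt (true ∷ u)  (true ∷ v)  h =
  let k , u≡ = hamming≡1⇒flipAt u v h in suc k , cong (true ∷_) u≡

hamming-flipAt : ∀ (k : Fin m) v → hamming (flipAt k v) v ≡ 1
hamming-flipAt zero    (false ∷ v) = cong suc (hamming-refl v)
hamming-flipAt zero    (true ∷ v)  = cong suc (hamming-refl v)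
hamming-flipAt (suc k) (false ∷ v) = hamming-flipAt k v
hamming-flipAt (suc k) (true ∷ v)  = hamming-flipAt k v

adjacent-flipAt : ∀ (k : Fin m) v → adjacent (flipAt k v) v ≡ true
adjacent-flipAt k v = Equivalence.to T-≡ (≡⇒≡ᵇ _ 1 (hamming-flipAt k v))

adjacent⇒flipAt : (u v : Vertex m) → adjacent u v ≡ true → ∃[ k ] u ≡ flipAt k v
adjacent⇒flipAt u v adj = hamming≡1⇒flipAt u v (≡ᵇ⇒≡ _ 1 (Equivalence.from T-≡ adj))

∈-allV : (v : Vertex m) → v ∈ allV m
∈-allV []          = here refl
∈-allV (false ∷ v) = ∈-++⁺ˡ (∈-map⁺ (false ∷_) (∈-allV v))
∈-allV (true ∷ v)  = ∈-++⁺ʳ _ (∈-map⁺ (true ∷_) (∈-allV v))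

any-allV⁺ : (p : Vertex m → Bool) (v : Vertex m) → p v ≡ true → any p (allV m) ≡ true
any-allV⁺ p v pv = Equivalence.to T-≡ (any⁺ p (lose (∈-allV v) (Equivalence.from T-≡ pv)))

any-allV⁻ : (p : Vertex m → Bool) → any p (allV m) ≡ true → ∃[ v ] p v ≡ true
any-allV⁻ {m} p h =
  let v , pv = satisfied (any⁻ p (allV m) (Equivalence.from T-≡ h)) in v , Equivalence.to T-≡ pv

∑ : (Vertex m → ℕ) → ℕ
∑ {zero}  g = g []
∑ {suc m} g = ∑ (g ∘ (false ∷_)) + ∑ (g ∘ (true ∷_))

∑-cong : {f g : Vertex m → ℕ} → (∀ v → f v ≡ g v) → ∑ f ≡ ∑ g
∑-cong {zero}  f≗g = f≗g []
∑-cong {suc m} f≗g = cong₂ _+_ (∑-cong (f≗g ∘ (false ∷_))) (∑-cong (f≗g ∘ (true ∷_)))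

∑-mono-≤ : {f g : Vertex m → ℕ} → (∀ v → f v ≤ g v) → ∑ f ≤ ∑ g
∑-mono-≤ {zero}  f≤g = f≤g []
∑-mono-≤ {suc m} f≤g = +-mono-≤ (∑-mono-≤ (f≤g ∘ (false ∷_))) (∑-mono-≤ (f≤g ∘ (true ∷_)))

∑-mono-< : {f g : Vertex m → ℕ} → (∀ v → f v ≤ g v) → ∀ v → f v < g v → ∑ f < ∑ g
∑-mono-< {zero}  f≤g []          lt = lt
∑-mono-< {suc m} f≤g (false ∷ v) lt =
  +-mono-<-≤ (∑-mono-< (f≤g ∘ (false ∷_)) v lt) (∑-mono-≤ (f≤g ∘ (true ∷_)))
∑-mono-< {suc m} f≤g (true ∷ v)  lt =
  +-mono-≤-< (∑-mono-≤ (f≤g ∘ (false ∷_))) (∑-mono-< (f≤g ∘ (true ∷_)) v lt)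

∑-distrib-+ : (f g : Vertex m → ℕ) → ∑ (λ v → f v + g v) ≡ ∑ f + ∑ g
∑-distrib-+ {zero}  f g = refl
∑-distrib-+ {suc m} f g = begin
  ∑ (λ v → f (false ∷ v) + g (false ∷ v)) + ∑ (λ v → f (true ∷ v) + g (true ∷ v))
    ≡⟨ cong₂ _+_ (∑-distrib-+ (f ∘ (false ∷_)) (g ∘ (false ∷_))) (∑-distrib-+ (f ∘ (true ∷_)) (g ∘ (true ∷_))) ⟩
  (∑ (f ∘ (false ∷_)) + ∑ (g ∘ (false ∷_))) + (∑ (f ∘ (true ∷_)) + ∑ (g ∘ (true ∷_)))
    ≡⟨ interchange (∑ (f ∘ (false ∷_))) (∑ (g ∘ (false ∷_))) (∑ (f ∘ (true ∷_))) (∑ (g ∘ (true ∷_))) ⟩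
  ∑ f + ∑ g ∎
  where open ≡-Reasoning

∑-zero : {g : Vertex m → ℕ} → (∀ v → g v ≡ 0) → ∑ g ≡ 0
∑-zero {zero}  g≡0 = g≡0 []
∑-zero {suc m} g≡0 = cong₂ _+_ (∑-zero (g≡0 ∘ (false ∷_))) (∑-zero (g≡0 ∘ (true ∷_)))

∑-flipAt : ∀ (k : Fin m) (g : Vertex m → ℕ) → ∑ (g ∘ flipAt k) ≡ ∑ g
∑-flipAt zero    g = +-comm (∑ (g ∘ (true ∷_))) (∑ (g ∘ (false ∷_)))
∑-flipAt (suc k) g = cong₂ _+_ (∑-flipAt k (g ∘ (false ∷_))) (∑-flipAt k (g ∘ (true ∷_)))

𝟙 : Bool → ℕ
𝟙 b = if b then 1 else 0

𝟙-mono : ∀ {a b} → (a ≡ true → b ≡ true) → 𝟙 a ≤ 𝟙 b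
𝟙-mono {false}        _   = z≤n
𝟙-mono {true} {true}  _   = ≤-refl
𝟙-mono {true} {false} a⇒b with () ← a⇒b refl

count : VSet m → ℕ
count A = ∑ (𝟙 ∘ A)

count-cong : {A B : VSet m} → (∀ v → A v ≡ B v) → count A ≡ count B
count-cong A≗B = ∑-cong (cong 𝟙 ∘ A≗B)

count-mono : {A B : VSet m} → A ⊆ B → count A ≤ count B
count-mono A⊆B = ∑-mono-≤ (λ v → 𝟙-mono (A⊆B v))

touches : VSet m → VSet m
touches {m} A w = any (λ u → A u ∧ adjacent u w) (allV m)

touches-flipAt : ∀ (A : VSet m) k w → A (flipAt k w) ≡ true → touches A w ≡ true
touches-flipAt A k w Au = any-allV⁺ _ (flipAt k w) (cong₂ _∧_ Au (adjacent-flipAt k w))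

touches⇒flipAt : ∀ (A : VSet m) w → touches A w ≡ true → ∃[ k ] A (flipAt k w) ≡ true
touches⇒flipAt A w h with any-allV⁻ _ h
... | u , Au∧adj with A u in Au | adjacent u w in adj
... | true | true = let k , u≡ = adjacent⇒flipAt u w adj in k , trans (cong A (sym u≡)) Au

Near : Vertex m → Vertex m → Set
Near u w = u ≡ w ⊎ ∃[ k ] u ≡ flipAt k w

Near-map : (f : Vertex m → Vertex m) → (∀ k v → ∃[ k′ ] f (flipAt k v) ≡ flipAt k′ (f v)) →
           ∀ {u w} → Near u w → Near (f u) (f w)
Near-map f f-flipAt (inj₁ refl)       = inj₁ refl
Near-map f f-flipAt (inj₂ (k , refl)) = inj₂ (f-flipAt k _)

Near-∷ : ∀ x {u w : Vertex m} → Near u w → Near (x ∷ u) (x ∷ w)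
Near-∷ x (inj₁ refl)       = inj₁ refl
Near-∷ x (inj₂ (k , refl)) = inj₂ (suc k , refl)

Near-flipAt : ∀ (k : Fin m) {u w} → Near u w → Near (flipAt k u) (flipAt k w)
Near-flipAt k = Near-map (flipAt k) (λ l v → l , flipAt-comm k l v)

N[_] : VSet m → VSet m
N[ A ] w = A w ∨ touches A w

N-intro : ∀ (A : VSet m) {u w} → A u ≡ true → Near u w → N[ A ] w ≡ true
N-intro A {w = w} Au (inj₁ refl)       = cong (_∨ touches A w) Au
N-intro A {w = w} Au (inj₂ (k , refl)) = trans (cong (A w ∨_) (touches-flipAt A k w Au)) (∨-zeroʳ (A w))

N-elim : ∀ (A : VSet m) w → N[ A ] w ≡ true → ∃[ u ] A u ≡ true × Near u w
N-elim A w h with A w in Aw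
... | true  = w , Aw , inj₁ refl
... | false = let k , Au = touches⇒flipAt A w h in flipAt k w , Au , inj₂ (k , refl)

⊆-N : (A : VSet m) → A ⊆ N[ A ]
⊆-N A w Aw = N-intro A Aw (inj₁ refl)

N-cong : {A B : VSet m} → (∀ v → A v ≡ B v) → ∀ w → N[ A ] w ≡ N[ B ] w
N-cong {m} A≗B w = cong₂ _∨_ (A≗B w) (cong or (map-cong (λ u → cong (_∧ _) (A≗B u)) (allV m)))

∃-vertex? : {P : Vertex m → Set} → (∀ v → Dec (P v)) → Dec (∃[ v ] P v)
∃-vertex? {zero}  P? = map′ ([] ,_) (λ { ([] , p) → p }) (P? [])
∃-vertex? {suc m} {P} P? =
  map′ [ (λ (v , p) → false ∷ v , p) , (λ (v , p) → true ∷ v , p) ]′ byHead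
       (∃-vertex? (P? ∘ (false ∷_)) ⊎-dec ∃-vertex? (P? ∘ (true ∷_)))
  where
  byHead : ∃[ v ] P v → (∃[ v ] P (false ∷ v)) ⊎ (∃[ v ] P (true ∷ v))
  byHead (false ∷ v , p) = inj₁ (v , p)
  byHead (true ∷ v , p)  = inj₂ (v , p)

m+m≤n+n⇒m≤n : ∀ {m n} → m + m ≤ n + n → m ≤ n
m+m≤n+n⇒m≤n le = ≮⇒≥ (λ n<m → <⇒≱ (+-mono-< n<m n<m) le)

m+m<n+n⇒m<n : ∀ {m n} → m + m < n + n → m < n
m+m<n+n⇒m<n lt = ≰⇒> (λ n≤m → <⇒≱ lt (+-mono-≤ n≤m n≤m))

-- Compressions

totalWeight : (Vertex m → ℕ) → VSet m → ℕ
totalWeight wt A = ∑ (λ v → if A v then wt v else 0)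

data Side : Set where
  low high fixed : Side

-- σ pairs high vertices with low ones; compressing a set moves its points from the high to the
-- low side of each pair.  Near-σ is what keeps closed neighbourhoods from growing.
record Compression (m : ℕ) : Set where
  field
    σ             : Vertex m → Vertex m
    side          : Vertex m → Side
    σ-involutive  : ∀ v → σ (σ v) ≡ v
    side-σ-low    : ∀ {v} → side v ≡ low → side (σ v) ≡ high
    side-σ-high   : ∀ {v} → side v ≡ high → side (σ v) ≡ low
    σ-fixed       : ∀ {v} → side v ≡ fixed → σ v ≡ v
    ∑-σ           : ∀ g → ∑ (g ∘ σ) ≡ ∑ g
    σ-Near        : ∀ {u w} → Near u w → Near (σ u) (σ w)
    Near-σ        : ∀ {u w} → side u ≡ low → side w ≡ high → Near u w → Near u (σ w)

module _ (ρ : Compression m) where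
  open Compression ρ

  private
    ∑-pair : ∀ f → ∑ (λ v → f v + f (σ v)) ≡ ∑ f + ∑ f
    ∑-pair f = trans (∑-distrib-+ f (f ∘ σ)) (cong (∑ f +_) (∑-σ f))

    pairwise : ∀ (f g : Vertex m → ℕ) →
               (∀ v → side v ≡ low → f v + f (σ v) ≤ g v + g (σ v)) →
               (∀ v → side v ≡ fixed → f v ≤ g v) →
               ∀ v → f v + f (σ v) ≤ g v + g (σ v)
    pairwise f g low≤ fixed≤ v with side v in eq
    ... | low   = low≤ v eq
    ... | fixed = subst (λ u → f v + f u ≤ g v + g u) (sym (σ-fixed eq)) (+-mono-≤ (fixed≤ v eq) (fixed≤ v eq))
    ... | high  = subst₂ _≤_ (swap f) (swap g) (low≤ (σ v) (side-σ-high eq))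
      where
      swap : ∀ h → h (σ v) + h (σ (σ v)) ≡ h v + h (σ v)
      swap h = trans (cong (λ u → h (σ v) + h u) (σ-involutive v)) (+-comm (h (σ v)) (h v))

  -- Summing f v + f (σ v) over all v counts every value of f twice, so comparing pairs suffices.
  ∑-mono-≤-pairs : ∀ (f g : Vertex m → ℕ) →
                   (∀ v → side v ≡ low → f v + f (σ v) ≤ g v + g (σ v)) →
                   (∀ v → side v ≡ fixed → f v ≤ g v) →
                   ∑ f ≤ ∑ g
  ∑-mono-≤-pairs f g low≤ fixed≤ =
    m+m≤n+n⇒m≤n (subst₂ _≤_ (∑-pair f) (∑-pair g) (∑-mono-≤ (pairwise f g low≤ fixed≤)))

  ∑-mono-<-pairs : ∀ (f g : Vertex m → ℕ) →
                   (∀ v → side v ≡ low → f v + f (σ v) ≤ g v + g (σ v)) →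
                   (∀ v → side v ≡ fixed → f v ≤ g v) →
                   ∀ v → f v + f (σ v) < g v + g (σ v) →
                   ∑ f < ∑ g
  ∑-mono-<-pairs f g low≤ fixed≤ v lt =
    m+m<n+n⇒m<n (subst₂ _<_ (∑-pair f) (∑-pair g) (∑-mono-< (pairwise f g low≤ fixed≤) v lt))

  compressAt : Side → Bool → Bool → Bool
  compressAt low   a b = a ∨ b
  compressAt high  a b = a ∧ b
  compressAt fixed a _ = a

  compress : VSet m → VSet m
  compress A v = compressAt (side v) (A v) (A (σ v))

  compress-low : ∀ A {v} → side v ≡ low → compress A v ≡ A v ∨ A (σ v)
  compress-low A eq rewrite eq = refl

  compress-high : ∀ A {v} → side v ≡ high → compress A v ≡ A v ∧ A (σ v)
  compress-high A eq rewrite eq = refl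

  compress-fixed : ∀ A {v} → side v ≡ fixed → compress A v ≡ A v
  compress-fixed A eq rewrite eq = refl

  compress-σ-low : ∀ A {v} → side v ≡ low → compress A (σ v) ≡ A (σ v) ∧ A v
  compress-σ-low A {v} eq = trans (compress-high A (side-σ-low eq)) (cong (λ u → A (σ v) ∧ A u) (σ-involutive v))

  count-compress : ∀ A → count (compress A) ≡ count A
  count-compress A = ≤-antisym
    (∑-mono-≤-pairs _ _ (λ v eq → ≤-reflexive (pair v eq)) (λ v eq → ≤-reflexive (unmoved v eq)))
    (∑-mono-≤-pairs _ _ (λ v eq → ≤-reflexive (sym (pair v eq))) (λ v eq → ≤-reflexive (sym (unmoved v eq))))
    where
    ∨∧ : ∀ a b → 𝟙 (a ∨ b) + 𝟙 (b ∧ a) ≡ 𝟙 a + 𝟙 b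
    ∨∧ true  true  = refl
    ∨∧ true  false = refl
    ∨∧ false true  = refl
    ∨∧ false false = refl
    pair : ∀ v → side v ≡ low → 𝟙 (compress A v) + 𝟙 (compress A (σ v)) ≡ 𝟙 (A v) + 𝟙 (A (σ v))
    pair v eq = trans (cong₂ (λ a b → 𝟙 a + 𝟙 b) (compress-low A eq) (compress-σ-low A eq)) (∨∧ (A v) (A (σ v)))
    unmoved : ∀ v → side v ≡ fixed → 𝟙 (compress A v) ≡ 𝟙 (A v)
    unmoved v eq = cong 𝟙 (compress-fixed A eq)

  compress⇒ : ∀ A u → compress A u ≡ true → A u ≡ true ⊎ A (σ u) ≡ true
  compress⇒ A u h with side u | A u | A (σ u)
  ... | low   | true  | _    = inj₁ refl
  ... | low   | false | true = inj₂ refl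
  ... | high  | true  | _    = inj₁ refl
  ... | fixed | true  | _    = inj₁ refl

  N-compress⇒ : ∀ A x → N[ compress A ] x ≡ true → N[ A ] x ≡ true ⊎ N[ A ] (σ x) ≡ true
  N-compress⇒ A x h with N-elim (compress A) x h
  ... | u , Cu , u~x with compress⇒ A u Cu
  ...   | inj₁ Au  = inj₁ (N-intro A Au u~x)
  ...   | inj₂ Aσu = inj₂ (N-intro A Aσu (σ-Near u~x))

  N-compress-high⇒ : ∀ A x → side x ≡ high → N[ compress A ] x ≡ true → N[ A ] x ≡ true × N[ A ] (σ x) ≡ true
  N-compress-high⇒ A x x-high h with N-elim (compress A) x h
  ... | u , Cu , u~x with side u in u-side
  ... | fixed = N-intro A Cu u~x , N-intro A Cu (subst (λ t → Near t (σ x)) (σ-fixed u-side) (σ-Near u~x))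
  ... | high with A u in Au | A (σ u) in Aσu
  ...   | true | true = N-intro A Au u~x , N-intro A Aσu (σ-Near u~x)
  N-compress-high⇒ A x x-high h | u , Cu , u~x | low with A u in Au | A (σ u) in Aσu
  ...   | true | _    = N-intro A Au u~x , N-intro A Au u~σx
    where
    u~σx : Near u (σ x)
    u~σx = Near-σ u-side x-high u~x
  ...   | false | true = N-intro A Aσu σu~x , N-intro A Aσu (σ-Near u~x)
    where
    σu~x : Near (σ u) x
    σu~x = subst (Near (σ u)) (σ-involutive x) (σ-Near (Near-σ u-side x-high u~x))

  count-N-compress : ∀ A → count N[ compress A ] ≤ count N[ A ]
  count-N-compress A = ∑-mono-≤-pairs _ _ low≤ fixed≤
    where
    𝟙-pair-≤ : ∀ {p q p′ q′} → (q ≡ true → p′ ≡ true × q′ ≡ true) → (p ≡ true → p′ ≡ true ⊎ q′ ≡ true) →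
               𝟙 p + 𝟙 q ≤ 𝟙 p′ + 𝟙 q′
    𝟙-pair-≤ {false} {false} _ _ = z≤n
    𝟙-pair-≤ {p} {true} q⇒ _ with q⇒ refl
    ... | refl , refl = +-monoˡ-≤ 1 (𝟙-mono {p} {true} λ _ → refl)
    𝟙-pair-≤ {true} {false} {p′} {q′} _ p⇒ with p⇒ refl
    ... | inj₁ refl = m≤m+n 1 (𝟙 q′)
    ... | inj₂ refl = m≤n+m 1 (𝟙 p′)
    low≤ : ∀ v → side v ≡ low → 𝟙 (N[ compress A ] v) + 𝟙 (N[ compress A ] (σ v)) ≤ 𝟙 (N[ A ] v) + 𝟙 (N[ A ] (σ v))
    low≤ v eq = 𝟙-pair-≤ partner (N-compress⇒ A v)
      where
      partner : N[ compress A ] (σ v) ≡ true → N[ A ] v ≡ true × N[ A ] (σ v) ≡ true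
      partner h = let Nσv , Nσσv = N-compress-high⇒ A (σ v) (side-σ-low eq) h
                  in subst (λ u → N[ A ] u ≡ true) (σ-involutive v) Nσσv , Nσv
    fixed≤ : ∀ v → side v ≡ fixed → 𝟙 (N[ compress A ] v) ≤ 𝟙 (N[ A ] v)
    fixed≤ v eq = 𝟙-mono λ h → [ id , subst (λ u → N[ A ] u ≡ true) (σ-fixed eq) ]′ (N-compress⇒ A v h)

  Violation : VSet m → Vertex m → Set
  Violation A v = side v ≡ high × A v ≡ true × A (σ v) ≡ false

  Stable : VSet m → Set
  Stable A = ∀ v → side v ≡ high → A v ≡ true → A (σ v) ≡ true

  violation? : ∀ A → Dec (∃[ v ] Violation A v)
  violation? A = ∃-vertex? (λ v → high? (side v) ×-dec (A v ≟ᵇ true) ×-dec (A (σ v) ≟ᵇ false))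
    where
    high? : ∀ s → Dec (s ≡ high)
    high? low   = no λ ()
    high? high  = yes refl
    high? fixed = no λ ()

  ¬violation⇒stable : ∀ A → ¬ (∃[ v ] Violation A v) → Stable A
  ¬violation⇒stable A ¬vio v v-high Av with A (σ v) in Aσv
  ... | true  = refl
  ... | false = contradiction (v , v-high , Av , Aσv) ¬vio

  totalWeight-compress : ∀ (wt : Vertex m → ℕ) → (∀ {v} → side v ≡ high → wt (σ v) < wt v) →
                         ∀ A {x} → Violation A x → totalWeight wt (compress A) < totalWeight wt A
  totalWeight-compress wt wt-σ A {x} (x-high , Ax , Aσx) = ∑-mono-<-pairs _ _ low≤ fixed≤ (σ x) strict
    where
    moveDown : ∀ a b {c e} → c < e →
               (if a ∨ b then c else 0) + (if b ∧ a then e else 0) ≤ (if a then c else 0) + (if b then e else 0)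
    moveDown true  true  _  = ≤-refl
    moveDown true  false _  = ≤-refl
    moveDown false true  lt = subst (_≤ _) (sym (+-identityʳ _)) (<⇒≤ lt)
    moveDown false false _  = ≤-refl
    low≤ : ∀ v → side v ≡ low →
           (if compress A v then wt v else 0) + (if compress A (σ v) then wt (σ v) else 0) ≤
           (if A v then wt v else 0) + (if A (σ v) then wt (σ v) else 0)
    low≤ v eq rewrite compress-low A eq | compress-σ-low A eq =
      moveDown (A v) (A (σ v)) (subst (λ u → wt u < wt (σ v)) (σ-involutive v) (wt-σ (side-σ-low eq)))
    fixed≤ : ∀ v → side v ≡ fixed → (if compress A v then wt v else 0) ≤ (if A v then wt v else 0)
    fixed≤ v eq rewrite compress-fixed A eq = ≤-refl
    σx-low : side (σ x) ≡ low
    σx-low = side-σ-high x-high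
    strict : (if compress A (σ x) then wt (σ x) else 0) + (if compress A (σ (σ x)) then wt (σ (σ x)) else 0) <
             (if A (σ x) then wt (σ x) else 0) + (if A (σ (σ x)) then wt (σ (σ x)) else 0)
    strict rewrite compress-low A σx-low | compress-σ-low A σx-low | Aσx | σ-involutive x | Ax =
      subst (_< wt x) (sym (+-identityʳ _)) (wt-σ x-high)

-- Down- and shift-compressions

hammingWeight : Vertex m → ℕ
hammingWeight []      = 0
hammingWeight (x ∷ v) = 𝟙 x + hammingWeight v

hammingWeight-flipAt-true : ∀ (k : Fin m) v → lookup v k ≡ true →
                            suc (hammingWeight (flipAt k v)) ≡ hammingWeight v
hammingWeight-flipAt-true zero    (true ∷ v) _  = refl
hammingWeight-flipAt-true (suc k) (x ∷ v)    eq =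
  trans (sym (+-suc (𝟙 x) _)) (cong (𝟙 x +_) (hammingWeight-flipAt-true k v eq))

hammingWeight-flipAt-false : ∀ (k : Fin m) v → lookup v k ≡ false →
                             hammingWeight (flipAt k v) ≡ suc (hammingWeight v)
hammingWeight-flipAt-false zero    (false ∷ v) _  = refl
hammingWeight-flipAt-false (suc k) (x ∷ v)     eq =
  trans (cong (𝟙 x +_) (hammingWeight-flipAt-false k v eq)) (+-suc (𝟙 x) _)

downSide : Bool → Side
downSide true  = high
downSide false = low

downSide-low : ∀ {b} → downSide b ≡ low → b ≡ false
downSide-low {false} _ = refl

downSide-high : ∀ {b} → downSide b ≡ high → b ≡ true
downSide-high {true} _ = refl

downSide-fixed : ∀ b → downSide b ≡ fixed → ⊥
downSide-fixed true  ()
downSide-fixed false ()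

down : Fin m → Compression m
down k = record
  { σ            = flipAt k
  ; side         = λ v → downSide (lookup v k)
  ; σ-involutive = flipAt-involutive k
  ; side-σ-low   = λ {v} eq → trans (cong downSide (lookup-flipAt k v)) (cong (downSide ∘ not) (downSide-low eq))
  ; side-σ-high  = λ {v} eq → trans (cong downSide (lookup-flipAt k v)) (cong (downSide ∘ not) (downSide-high eq))
  ; σ-fixed      = λ {v} eq → ⊥-elim (downSide-fixed (lookup v k) eq)
  ; ∑-σ          = ∑-flipAt k
  ; σ-Near       = Near-flipAt k
  ; Near-σ       = low-near-high
  }
  where
  low-near-high : ∀ {u w} → downSide (lookup u k) ≡ low → downSide (lookup w k) ≡ high →
                  Near u w → Near u (flipAt k w)
  low-near-high u-low w-high (inj₁ refl) =
    contradiction (trans (sym (downSide-low u-low)) (downSide-high w-high)) λ ()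
  low-near-high {w = w} u-low w-high (inj₂ (l , refl)) with k ≟ᶠ l
  ... | yes refl = inj₁ refl
  ... | no k≢l   =
    contradiction (trans (sym (downSide-low u-low)) (trans (lookup-flipAt′ k l w k≢l) (downSide-high w-high))) λ ()

swapHead : Fin m → Vertex (suc m) → Vertex (suc m)
swapHead j (x ∷ w) = lookup w j ∷ updateAt w j (const x)

swapHead-involutive : ∀ (j : Fin m) v → swapHead j (swapHead j v) ≡ v
swapHead-involutive j (x ∷ w) =
  cong₂ _∷_ (lookup∘updateAt j w) (trans (updateAt-updateAt j w) (updateAt-id-local j w refl))

swapHead-fixed : ∀ (j : Fin m) x w → x ≡ lookup w j → swapHead j (x ∷ w) ≡ x ∷ w
swapHead-fixed j x w eq = cong₂ _∷_ (sym eq) (updateAt-id-local j w eq)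

swapHead-true∷ : ∀ (j : Fin m) w → lookup w j ≡ false → swapHead j (true ∷ w) ≡ false ∷ flipAt j w
swapHead-true∷ j w eq = cong₂ _∷_ eq (updateAt-cong-local j w (sym (cong not eq)))

swapHead-flipAt : ∀ (j : Fin m) k v → ∃[ k′ ] swapHead j (flipAt k v) ≡ flipAt k′ (swapHead j v)
swapHead-flipAt j zero    (x ∷ w) = suc j , cong (lookup w j ∷_) (sym (updateAt-updateAt j w))
swapHead-flipAt j (suc k) (x ∷ w) with j ≟ᶠ k
... | yes refl = zero , cong₂ _∷_ (lookup-flipAt j w) (updateAt-updateAt j w)
... | no j≢k   = suc k , cong₂ _∷_ (lookup-flipAt′ j k w j≢k) (updateAt-commutes j k j≢k w)

∑-swapHead : ∀ (j : Fin m) (g : Vertex (suc m) → ℕ) → ∑ (g ∘ swapHead j) ≡ ∑ g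
∑-swapHead zero g =
  interchange (∑ (g ∘ (false ∷_) ∘ (false ∷_))) (∑ (g ∘ (true ∷_) ∘ (false ∷_)))
              (∑ (g ∘ (false ∷_) ∘ (true ∷_))) (∑ (g ∘ (true ∷_) ∘ (true ∷_)))
∑-swapHead {suc m} (suc j) g = begin
  ∑ (g ∘ swapHead (suc j))                      ≡⟨ ∑-cong {g = g ∘ swapHead zero ∘ inner ∘ swapHead zero} unfold ⟩
  ∑ (g ∘ swapHead zero ∘ inner ∘ swapHead zero) ≡⟨ ∑-swapHead zero (g ∘ swapHead zero ∘ inner) ⟩
  ∑ (g ∘ swapHead zero ∘ inner)                 ≡⟨ cong₂ _+_ (∑-swapHead j (half false))
                                                                (∑-swapHead j (half true)) ⟩
  ∑ (g ∘ swapHead zero)                         ≡⟨ ∑-swapHead zero g ⟩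
  ∑ g                                           ∎
  where
  open ≡-Reasoning
  inner : Vertex (suc (suc m)) → Vertex (suc (suc m))
  inner (y ∷ v) = y ∷ swapHead j v
  unfold : ∀ v → g (swapHead (suc j) v) ≡ g (swapHead zero (inner (swapHead zero v)))
  unfold (x ∷ y ∷ w) = refl
  half : Bool → Vertex (suc m) → ℕ
  half y v = g (swapHead zero (y ∷ v))

shiftSide : Bool → Bool → Side
shiftSide true  false = high
shiftSide false true  = low
shiftSide true  true  = fixed
shiftSide false false = fixed

shiftSide-low : ∀ {a b} → shiftSide a b ≡ low → a ≡ false × b ≡ true
shiftSide-low {false} {true}  _  = refl , refl
shiftSide-low {false} {false} ()
shiftSide-low {true}  {false} ()
shiftSide-low {true}  {true}  ()

shiftSide-high : ∀ {a b} → shiftSide a b ≡ high → a ≡ true × b ≡ false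
shiftSide-high {true}  {false} _  = refl , refl
shiftSide-high {true}  {true}  ()
shiftSide-high {false} {false} ()
shiftSide-high {false} {true}  ()

shiftSide-fixed : ∀ {a b} → shiftSide a b ≡ fixed → a ≡ b
shiftSide-fixed {true}  {true}  _ = refl
shiftSide-fixed {false} {false} _ = refl

shift : Fin m → Compression (suc m)
shift j = record
  { σ            = swapHead j
  ; side         = side
  ; σ-involutive = swapHead-involutive j
  ; side-σ-low   = λ {v} → side-σ-low v
  ; side-σ-high  = λ {v} → side-σ-high v
  ; σ-fixed      = λ {v} → σ-fixed v
  ; ∑-σ          = ∑-swapHead j
  ; σ-Near       = Near-map (swapHead j) (swapHead-flipAt j)
  ; Near-σ       = λ {u} {w} u-low w-high u~w → ⊥-elim (low≁high u w u-low w-high u~w)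
  }
  where
  side : Vertex (suc _) → Side
  side (x ∷ w) = shiftSide x (lookup w j)
  side-swapHead : ∀ x w → side (swapHead j (x ∷ w)) ≡ shiftSide (lookup w j) x
  side-swapHead x w = cong (shiftSide (lookup w j)) (lookup∘updateAt j w)
  side-σ-low : ∀ v → side v ≡ low → side (swapHead j v) ≡ high
  side-σ-low (x ∷ w) eq = let x≡f , wj≡t = shiftSide-low eq in
    trans (side-swapHead x w) (cong₂ shiftSide wj≡t x≡f)
  side-σ-high : ∀ v → side v ≡ high → side (swapHead j v) ≡ low
  side-σ-high (x ∷ w) eq = let x≡t , wj≡f = shiftSide-high eq in
    trans (side-swapHead x w) (cong₂ shiftSide wj≡f x≡t)
  σ-fixed : ∀ v → side v ≡ fixed → swapHead j v ≡ v
  σ-fixed (x ∷ w) eq = swapHead-fixed j x w (shiftSide-fixed eq)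
  low≁high : ∀ u w → side u ≡ low → side w ≡ high → Near u w → ⊥
  low≁high (x ∷ u) (y ∷ w) u-low w-high u~w with shiftSide-low u-low | shiftSide-high w-high | u~w
  ... | refl , uj≡t | refl , wj≡f | inj₁ ()
  ... | refl , uj≡t | refl , wj≡f | inj₂ (zero , u≡w) =
    contradiction (trans (sym uj≡t) (trans (cong (λ v → lookup v j) (proj₂ (∷-injective u≡w))) wj≡f)) λ ()
  ... | refl , uj≡t | refl , wj≡f | inj₂ (suc k , ())

-- The head coordinate counts twice, so that moving a 1 from the head into the tail
-- (a shift) also lowers the potential.
potential : Vertex (suc m) → ℕ
potential (x ∷ w) = 2 * 𝟙 x + hammingWeight w

down-potential : ∀ (k : Fin (suc m)) {v} → Compression.side (down k) v ≡ high →
                 potential (flipAt k v) < potential v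
down-potential zero    {true ∷ w} _  = s≤s (n≤1+n _)
down-potential (suc k) {x ∷ w}    eq =
  +-monoʳ-< (2 * 𝟙 x) (≤-reflexive (hammingWeight-flipAt-true k w (downSide-high eq)))

shift-potential : ∀ (j : Fin m) {v} → Compression.side (shift j) v ≡ high →
                  potential (swapHead j v) < potential v
shift-potential j {x ∷ w} eq with shiftSide-high eq
... | refl , wj≡f = begin-strict
  potential (swapHead j (true ∷ w)) ≡⟨ cong potential (swapHead-true∷ j w wj≡f) ⟩
  hammingWeight (flipAt j w)        ≡⟨ hammingWeight-flipAt-false j w wj≡f ⟩
  suc (hammingWeight w)             <⟨ n<1+n _ ⟩
  potential (true ∷ w)              ∎
  where open ≤-Reasoning

Compressed : VSet (suc m) → Set
Compressed Z = (∀ k → Stable (down k) Z) × (∀ j → Stable (shift j) Z)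

compressed-exists : ∀ (A : VSet (suc m)) → ∃[ Z ] Compressed Z × count Z ≡ count A × count N[ Z ] ≤ count N[ A ]
compressed-exists A = go A (<-wellFounded (totalWeight potential A))
  where
  Result : VSet (suc _) → Set
  Result A = ∃[ Z ] Compressed Z × count Z ≡ count A × count N[ Z ] ≤ count N[ A ]
  step : ∀ (ρ : Compression (suc _)) →
         (∀ {v} → Compression.side ρ v ≡ high → potential (Compression.σ ρ v) < potential v) →
         ∀ A → ∃[ v ] Violation ρ A v →
         (∀ {B} → totalWeight potential B < totalWeight potential A → Result B) → Result A
  step ρ ρ-potential A (v , vio) recurse =
    let Z , Z-compressed , count≡ , N≤ = recurse (totalWeight-compress ρ potential ρ-potential A vio)
    in Z , Z-compressed , trans count≡ (count-compress ρ A) , ≤-trans N≤ (count-N-compress ρ A)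
  go : ∀ A → Acc _<_ (totalWeight potential A) → Result A
  go A (acc rec) with any? (λ k → violation? (down k) A)
  ... | yes (k , vio) = step (down k) (λ {v} → down-potential k {v}) A vio (λ lt → go _ (rec lt))
  ... | no no-down with any? (λ j → violation? (shift j) A)
  ...   | yes (j , vio) = step (shift j) (λ {v} → shift-potential j {v}) A vio (λ lt → go _ (rec lt))
  ...   | no no-shift =
    A , ((λ k → ¬violation⇒stable (down k) A (no-down ∘ (k ,_))) ,
         (λ j → ¬violation⇒stable (shift j) A (no-shift ∘ (j ,_)))) , refl , ≤-refl

lower upper : VSet (suc m) → VSet m
lower Z w = Z (false ∷ w)
upper Z w = Z (true ∷ w)

count-N-lower : (Z : VSet (suc m)) → count N[ lower Z ] + count (lower Z) ≤ count N[ Z ]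
count-N-lower Z = +-mono-≤ (count-mono N-lower⊆) (count-mono lower⊆)
  where
  N-lower⊆ : N[ lower Z ] ⊆ lower N[ Z ]
  N-lower⊆ w h = let u , Zu , u~w = N-elim (lower Z) w h in N-intro Z Zu (Near-∷ false u~w)
  lower⊆ : lower Z ⊆ upper N[ Z ]
  lower⊆ w Zw = N-intro Z Zw (inj₂ (zero , refl))

N-upper⊆lower : (Z : VSet (suc m)) → Compressed Z → N[ upper Z ] ⊆ lower Z
N-upper⊆lower Z (down-stable , shift-stable) w h with N-elim (upper Z) w h
... | u , Zu , inj₁ refl = down-stable zero (true ∷ u) refl Zu
... | u , Zu , inj₂ (j , u≡) = subst (λ v → Z (false ∷ v) ≡ true) w≡ (via (lookup u j) refl)
  where
  w≡ : flipAt j u ≡ w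
  w≡ = trans (cong (flipAt j) u≡) (flipAt-involutive j w)
  via : ∀ b → lookup u j ≡ b → Z (false ∷ flipAt j u) ≡ true
  via true  uj = down-stable (suc j) (false ∷ u) (cong downSide uj) (down-stable zero (true ∷ u) refl Zu)
  via false uj = subst (λ v → Z v ≡ true) (swapHead-true∷ j u uj)
                       (shift-stable j (true ∷ u) (cong (shiftSide true) uj) Zu)

-- A vertex-isoperimetric inequality for pairs of sets

≤-from-sum : ∀ {x y a b} → x + y ≤ a + b → (y < b → x ≤ a) → x ≤ a
≤-from-sum {x} {a = a} sum≤ y<b⇒ with x ≤? a
... | yes x≤a = x≤a
... | no  x≰a = y<b⇒ (≰⇒> λ b≤y → <⇒≱ (+-mono-<-≤ (≰⇒> x≰a) b≤y) sum≤)

-- F m r is the total size of an extremal pair in Q^m, whose closed neighbourhoods have total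
-- size F m (suc r).
record Profile (F : ℕ → ℕ → ℕ) : Set where
  field
    F-base   : ∀ s → F 0 (suc (suc s)) ≤ F 0 (suc s)
    F-one    : ∀ m → F m 1 ≤ suc (F m 0)
    F-pascal : ∀ m r → F (suc m) (suc r) ≡ F m (suc r) + F m r

module _ {F : ℕ → ℕ → ℕ} (profile : Profile F) where
  open Profile profile

  Isoperimetric : ℕ → Set
  Isoperimetric m = ∀ s (Y₁ Y₂ : VSet m) →
    F m (suc s) ≤ count Y₁ + count Y₂ → F m (suc (suc s)) ≤ count N[ Y₁ ] + count N[ Y₂ ]

  private
    N-mono₂ : ∀ {m} (Y₁ Y₂ : VSet m) → count Y₁ + count Y₂ ≤ count N[ Y₁ ] + count N[ Y₂ ]
    N-mono₂ Y₁ Y₂ = +-mono-≤ (count-mono (⊆-N Y₁)) (count-mono (⊆-N Y₂))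

    N-above : ∀ {m} → Isoperimetric m → ∀ s (Y₁ Y₂ : VSet m) →
              F m s < count Y₁ + count Y₂ → F m (suc s) ≤ count N[ Y₁ ] + count N[ Y₂ ]
    N-above {m} iso zero    Y₁ Y₂ lt = ≤-trans (F-one m) (≤-trans lt (N-mono₂ Y₁ Y₂))
    N-above     iso (suc s) Y₁ Y₂ lt = iso s Y₁ Y₂ (<⇒≤ lt)

  isoperimetric-compressed : ∀ {m} → Isoperimetric m →
    ∀ s (Z₁ Z₂ : VSet (suc m)) → Compressed Z₁ → Compressed Z₂ →
    F (suc m) (suc s) ≤ count Z₁ + count Z₂ → F (suc m) (suc (suc s)) ≤ count N[ Z₁ ] + count N[ Z₂ ]
  isoperimetric-compressed {m} iso s Z₁ Z₂ c₁ c₂ large = begin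
    F (suc m) (suc (suc s))
      ≡⟨ F-pascal m (suc s) ⟩
    F m (suc (suc s)) + F m (suc s)
      ≤⟨ +-mono-≤ (iso s (lower Z₁) (lower Z₂) lower-large) lower-large ⟩
    (count N[ lower Z₁ ] + count N[ lower Z₂ ]) + (count (lower Z₁) + count (lower Z₂))
      ≡⟨ interchange (count N[ lower Z₁ ]) _ _ _ ⟩
    (count N[ lower Z₁ ] + count (lower Z₁)) + (count N[ lower Z₂ ] + count (lower Z₂))
      ≤⟨ +-mono-≤ (count-N-lower Z₁) (count-N-lower Z₂) ⟩
    count N[ Z₁ ] + count N[ Z₂ ]
      ∎
    where
    open ≤-Reasoning
    upper≤lower : count N[ upper Z₁ ] + count N[ upper Z₂ ] ≤ count (lower Z₁) + count (lower Z₂)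
    upper≤lower = +-mono-≤ (count-mono (N-upper⊆lower Z₁ c₁)) (count-mono (N-upper⊆lower Z₂ c₂))
    -- If the lower halves were too small, the upper halves would exceed F m s, and then their
    -- neighbourhoods, which lie inside the lower halves, would already reach F m (suc s).
    lower-large : F m (suc s) ≤ count (lower Z₁) + count (lower Z₂)
    lower-large = ≤-from-sum
      (subst₂ _≤_ (F-pascal m s) (interchange (count (lower Z₁)) (count (upper Z₁)) _ _) large)
      (λ lt → ≤-trans (N-above iso s (upper Z₁) (upper Z₂) lt) upper≤lower)

  isoperimetric : ∀ m → Isoperimetric m
  isoperimetric zero    s Y₁ Y₂ large = ≤-trans (F-base s) (≤-trans large (N-mono₂ Y₁ Y₂))
  isoperimetric (suc m) s Y₁ Y₂ large =
    let Z₁ , c₁ , count₁ , N₁ = compressed-exists Y₁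
        Z₂ , c₂ , count₂ , N₂ = compressed-exists Y₂
    in ≤-trans (isoperimetric-compressed (isoperimetric m) s Z₁ Z₂ c₁ c₂
                  (subst (F (suc m) (suc s) ≤_) (sym (cong₂ _+_ count₁ count₂)) large))
               (+-mono-≤ N₁ N₂)

-- Hamming balls

ballSize : ℕ → ℕ → ℕ
ballSize m       zero    = 0
ballSize zero    (suc r) = 1
ballSize (suc m) (suc r) = ballSize m (suc r) + ballSize m r

ballSize-1 : ∀ m → ballSize m 1 ≡ 1
ballSize-1 zero    = refl
ballSize-1 (suc m) = trans (+-identityʳ (ballSize m 1)) (ballSize-1 m)

ballSize-full : ∀ m r → m < r → ballSize m r ≡ 2 ^ m
ballSize-full zero    (suc r) _         = refl
ballSize-full (suc m) (suc r) (s≤s m<r) =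
  trans (cong₂ _+_ (ballSize-full m (suc r) (m<n⇒m<1+n m<r)) (ballSize-full m r m<r))
        (cong (2 ^ m +_) (sym (+-identityʳ (2 ^ m))))

ballSize-profile : Profile ballSize
ballSize-profile = record
  { F-base   = λ _ → ≤-refl
  ; F-one    = λ m → ≤-reflexive (ballSize-1 m)
  ; F-pascal = λ _ _ → refl
  }

cube+-profile : ∀ {F} → Profile F → Profile (λ m r → 2 ^ m + F m r)
cube+-profile {F} profile = record
  { F-base   = λ s → +-monoʳ-≤ 1 (F-base s)
  ; F-one    = λ m → subst (2 ^ m + F m 1 ≤_) (+-suc (2 ^ m) (F m 0)) (+-monoʳ-≤ (2 ^ m) (F-one m))
  ; F-pascal = λ m r → begin
      2 ^ suc m + F (suc m) (suc r)
        ≡⟨ cong₂ _+_ (cong (2 ^ m +_) (+-identityʳ (2 ^ m))) (F-pascal m r) ⟩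
      (2 ^ m + 2 ^ m) + (F m (suc r) + F m r)
        ≡⟨ interchange (2 ^ m) (2 ^ m) (F m (suc r)) (F m r) ⟩
      (2 ^ m + F m (suc r)) + (2 ^ m + F m r)
        ∎
  }
  where
  open Profile profile
  open ≡-Reasoning

ball : ∀ {m} → ℕ → VSet m
ball r w = hammingWeight w <ᵇ r

ball⇒< : ∀ {m r} (w : Vertex m) → ball r w ≡ true → hammingWeight w < r
ball⇒< {r = r} w h = <ᵇ⇒< (hammingWeight w) r (Equivalence.from T-≡ h)

<⇒ball : ∀ {m r} (w : Vertex m) → hammingWeight w < r → ball r w ≡ true
<⇒ball w lt = Equivalence.to T-≡ (<⇒<ᵇ lt)

count-ball : ∀ m r → count (ball {m} r) ≡ ballSize m r
count-ball zero    zero    = refl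
count-ball zero    (suc r) = refl
count-ball (suc m) zero    = ∑-zero {suc m} {𝟙 ∘ ball 0} (λ _ → refl)
count-ball (suc m) (suc r) = cong₂ _+_ (count-ball m (suc r)) (count-ball m r)

hammingWeight-Near : ∀ {m} {u w : Vertex m} → Near u w → hammingWeight w ≤ suc (hammingWeight u)
hammingWeight-Near (inj₁ refl) = n≤1+n _
hammingWeight-Near {w = w} (inj₂ (k , refl)) with lookup w k in wk
... | true  = ≤-reflexive (sym (hammingWeight-flipAt-true k w wk))
... | false = ≤-trans (m≤n+m _ 2) (≤-reflexive (sym (cong suc (hammingWeight-flipAt-false k w wk))))

hammingWeight>0 : ∀ {m} (w : Vertex m) → 0 < hammingWeight w → ∃[ k ] lookup w k ≡ true
hammingWeight>0 (true ∷ w)  _  = zero , refl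
hammingWeight>0 (false ∷ w) pos = let k , wk = hammingWeight>0 w pos in suc k , wk

N-ball : ∀ {m} r (w : Vertex m) → N[ ball (suc r) ] w ≡ ball (suc (suc r)) w
N-ball r w = ⇔→≡ (mk⇔ to from)
  where
  to : N[ ball (suc r) ] w ≡ true → ball (suc (suc r)) w ≡ true
  to h = let u , u∈ , u~w = N-elim (ball (suc r)) w h in
    <⇒ball w (s≤s (≤-trans (hammingWeight-Near u~w) (ball⇒< u u∈)))
  from : ball (suc (suc r)) w ≡ true → N[ ball (suc r) ] w ≡ true
  from h with m<1+n⇒m<n∨m≡n (ball⇒< w h)
  ... | inj₁ lt = ⊆-N (ball (suc r)) w (<⇒ball w lt)
  ... | inj₂ eq = let k , wk = hammingWeight>0 w (subst (0 <_) (sym eq) z<s) in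
    N-intro (ball (suc r)) (<⇒ball (flipAt k w) (≤-reflexive (trans (hammingWeight-flipAt-true k w wk) eq)))
            (inj₂ (k , refl))

-- Even sets in a layer of Q^(m+2)

countL-++ : ∀ {A : Set} (p : A → Bool) xs ys → countL p (xs ++ ys) ≡ countL p xs + countL p ys
countL-++ p []       ys = refl
countL-++ p (x ∷ xs) ys = trans (cong (𝟙 (p x) +_) (countL-++ p xs ys)) (sym (+-assoc (𝟙 (p x)) _ _))

countL-map : ∀ {A B : Set} (p : B → Bool) (f : A → B) xs → countL p (map f xs) ≡ countL (p ∘ f) xs
countL-map p f []       = refl
countL-map p f (x ∷ xs) = cong (𝟙 (p (f x)) +_) (countL-map p f xs)

card≡count : (A : VSet m) → card A ≡ count A
card≡count {zero}  A = +-identityʳ (𝟙 (A []))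
card≡count {suc m} A = begin
  countL A (map (false ∷_) (allV m) ++ map (true ∷_) (allV m))
    ≡⟨ countL-++ A (map (false ∷_) (allV m)) (map (true ∷_) (allV m)) ⟩
  countL A (map (false ∷_) (allV m)) + countL A (map (true ∷_) (allV m))
    ≡⟨ cong₂ _+_ (countL-map A (false ∷_) (allV m)) (countL-map A (true ∷_) (allV m)) ⟩
  card (A ∘ (false ∷_)) + card (A ∘ (true ∷_))
    ≡⟨ cong₂ _+_ (card≡count (A ∘ (false ∷_))) (card≡count (A ∘ (true ∷_))) ⟩
  count A ∎
  where open ≡-Reasoning

∑-∷ʳ : (h : Vertex (suc m) → ℕ) → ∑ h ≡ ∑ (λ w → h (w ∷ʳ false)) + ∑ (λ w → h (w ∷ʳ true))
∑-∷ʳ {zero}  h = refl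
∑-∷ʳ {suc m} h = begin
  ∑ (h ∘ (false ∷_)) + ∑ (h ∘ (true ∷_))
    ≡⟨ cong₂ _+_ (∑-∷ʳ (h ∘ (false ∷_))) (∑-∷ʳ (h ∘ (true ∷_))) ⟩
  (∑ (λ w → h (false ∷ (w ∷ʳ false))) + ∑ (λ w → h (false ∷ (w ∷ʳ true)))) +
  (∑ (λ w → h (true ∷ (w ∷ʳ false))) + ∑ (λ w → h (true ∷ (w ∷ʳ true))))
    ≡⟨ interchange (∑ (λ w → h (false ∷ (w ∷ʳ false)))) _ _ _ ⟩
  ∑ (λ w → h (w ∷ʳ false)) + ∑ (λ w → h (w ∷ʳ true)) ∎
  where open ≡-Reasoning

∑-select-last : (h : Vertex (suc m) → ℕ) (c : Bool) → (∀ w → h (w ∷ʳ not c) ≡ 0) → ∑ h ≡ ∑ (λ w → h (w ∷ʳ c))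
∑-select-last h false vanish =
  trans (∑-∷ʳ h) (trans (cong (∑ (λ w → h (w ∷ʳ false)) +_) (∑-zero vanish)) (+-identityʳ _))
∑-select-last h true  vanish = trans (∑-∷ʳ h) (cong (_+ ∑ (λ w → h (w ∷ʳ true))) (∑-zero vanish))

∑-select-head : (h : Vertex (suc m) → ℕ) (f : Vertex m → Bool) → (∀ x t → x ≢ f t → h (x ∷ t) ≡ 0) →
                ∑ h ≡ ∑ (λ t → h (f t ∷ t))
∑-select-head h f vanish = trans (sym (∑-distrib-+ (h ∘ (false ∷_)) (h ∘ (true ∷_)))) (∑-cong pointwise)
  where
  pointwise : ∀ t → h (false ∷ t) + h (true ∷ t) ≡ h (f t ∷ t)
  pointwise t with f t in ft
  ... | false = trans (cong (h (false ∷ t) +_) (vanish true t λ t≡ → contradiction (trans t≡ ft) λ ()))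
                      (+-identityʳ _)
  ... | true  = cong (_+ h (true ∷ t)) (vanish false t λ f≡ → contradiction (trans f≡ ft) λ ())

%2-+2 : ∀ n → (2 + n) % 2 ≡ n % 2
%2-+2 n = trans (cong (_% 2) (+-comm 2 n)) ([m+n]%n≡m%n n 2)

even-suc : ∀ n → (suc n % 2 ≡ᵇ 0) ≡ not (n % 2 ≡ᵇ 0)
even-suc zero          = refl
even-suc (suc zero)    = refl
even-suc (suc (suc n)) =
  trans (cong (_≡ᵇ 0) (%2-+2 (suc n))) (trans (even-suc n) (cong (λ r → not (r ≡ᵇ 0)) (sym (%2-+2 n))))

isEven-true∷ : (t : Vertex m) → isEven (true ∷ t) ≡ isEven t
isEven-true∷ t = cong (_≡ᵇ 0) (%2-+2 (coordSum t))

isEven-false∷ : (t : Vertex m) → isEven (false ∷ t) ≡ not (isEven t)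
isEven-false∷ t = even-suc (coordSum t)

isEven-flipAt : ∀ (k : Fin m) v → isEven (flipAt k v) ≡ not (isEven v)
isEven-flipAt zero    (true ∷ t)  = trans (isEven-false∷ t) (cong not (sym (isEven-true∷ t)))
isEven-flipAt zero    (false ∷ t) =
  trans (isEven-true∷ t) (trans (sym (not-involutive _)) (cong not (sym (isEven-false∷ t))))
isEven-flipAt (suc k) (true ∷ t)  =
  trans (isEven-true∷ (flipAt k t)) (trans (isEven-flipAt k t) (cong not (sym (isEven-true∷ t))))
isEven-flipAt (suc k) (false ∷ t) =
  trans (isEven-false∷ (flipAt k t)) (cong not (trans (isEven-flipAt k t) (sym (isEven-false∷ t))))

isEven-head : ∀ x (t : Vertex m) → isEven (x ∷ t) ≡ true → x ≡ isEven t
isEven-head true  t h = sym (trans (sym (isEven-true∷ t)) h)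
isEven-head false t h = sym (not-injective (trans (sym (isEven-false∷ t)) h))

isEven-evenLift : (t : Vertex m) → isEven (isEven t ∷ t) ≡ true
isEven-evenLift t with isEven t in e
... | true  = trans (isEven-true∷ t) e
... | false = trans (isEven-false∷ t) (cong not e)

lastC-∷ʳ : ∀ x (w : Vertex m) c → lastC (x ∷ (w ∷ʳ c)) ≡ c
lastC-∷ʳ x []      c = refl
lastC-∷ʳ x (y ∷ w) c = lastC-∷ʳ y w c

flipAt-inject₁-∷ʳ : ∀ (k : Fin m) w c → flipAt (inject₁ k) (w ∷ʳ c) ≡ flipAt k w ∷ʳ c
flipAt-inject₁-∷ʳ zero    (x ∷ w) c = refl
flipAt-inject₁-∷ʳ (suc k) (x ∷ w) c = cong (x ∷_) (flipAt-inject₁-∷ʳ k w c)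

flipAt-∷ʳ : ∀ (k : Fin (suc m)) w c →
            (∃[ k′ ] flipAt k (w ∷ʳ c) ≡ flipAt k′ w ∷ʳ c) ⊎ flipAt k (w ∷ʳ c) ≡ w ∷ʳ not c
flipAt-∷ʳ zero    []      c = inj₂ refl
flipAt-∷ʳ zero    (x ∷ w) c = inj₁ (zero , refl)
flipAt-∷ʳ (suc k) (x ∷ w) c with flipAt-∷ʳ k w c
... | inj₁ (k′ , eq) = inj₁ (suc k′ , cong (x ∷_) eq)
... | inj₂ eq        = inj₂ (cong (x ∷_) eq)

-- Q is the layer of vertices x ∷ (w ∷ʳ c).  Over each w it contains one even vertex and one odd
-- one, so an even X ⊆ Q is encoded by its trace on Q^m.
module Layer {m} (c : Bool) (Q : VSet (suc (suc m)))
  (Q-c : ∀ x w → Q (x ∷ (w ∷ʳ c)) ≡ true) (Q-¬c : ∀ x w → Q (x ∷ (w ∷ʳ not c)) ≡ false) where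

  evenOver oddOver : Vertex m → Vertex (suc (suc m))
  evenOver w = isEven (w ∷ʳ c) ∷ (w ∷ʳ c)
  oddOver  w = not (isEven (w ∷ʳ c)) ∷ (w ∷ʳ c)

  trace : VSet (suc (suc m)) → VSet m
  trace X = X ∘ evenOver

  module _ (X : VSet (suc (suc m))) (X⊆Q : X ⊆ Q) (X-even : EvenSet X) where

    X-outside : ∀ x t → x ≢ isEven t → X (x ∷ t) ≡ false
    X-outside x t x≢ with X (x ∷ t) in Xv
    ... | false = refl
    ... | true  = contradiction (isEven-head x t (X-even _ Xv)) x≢

    X-¬c : ∀ x w → X (x ∷ (w ∷ʳ not c)) ≡ false
    X-¬c x w with X (x ∷ (w ∷ʳ not c)) in Xv
    ... | false = refl
    ... | true  = contradiction (trans (sym (X⊆Q _ Xv)) (Q-¬c x w)) λ ()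

    X⇒trace : ∀ x w → X (x ∷ (w ∷ʳ c)) ≡ true → trace X w ≡ true
    X⇒trace x w Xv = subst (λ y → X (y ∷ (w ∷ʳ c)) ≡ true) (isEven-head x (w ∷ʳ c) (X-even _ Xv)) Xv

    card-trace : card X ≡ count (trace X)
    card-trace = begin
      card X                         ≡⟨ card≡count X ⟩
      count X                        ≡⟨ ∑-select-head (𝟙 ∘ X) isEven (λ x t x≢ → cong 𝟙 (X-outside x t x≢)) ⟩
      ∑ (λ t → 𝟙 (X (isEven t ∷ t))) ≡⟨ ∑-select-last (λ t → 𝟙 (X (isEven t ∷ t))) c (λ w → cong 𝟙 (X-¬c _ w)) ⟩
      count (trace X)                ∎
      where open ≡-Reasoning

    -- Neighbours of an even vertex are odd, and X contains only even vertices.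
    boundary-even : ∀ v → isEven v ≡ true → boundary X v ≡ false
    boundary-even v ev with touches X v in h
    ... | false = ∧-zeroʳ (not (X v))
    ... | true  = let k , Xk = touches⇒flipAt X v h in
      contradiction (trans (sym (X-even _ Xk)) (trans (isEven-flipAt k v) (cong not ev))) λ ()

    boundary-oddOver : ∀ w → boundary X (oddOver w) ≡ N[ trace X ] w
    boundary-oddOver w = trans (cong (λ b → not b ∧ touches X (oddOver w)) X-odd) (⇔→≡ (mk⇔ to from))
      where
      X-odd : X (oddOver w) ≡ false
      X-odd = X-outside _ _ (λ eq → contradiction (sym eq) (not-¬ refl))
      to : touches X (oddOver w) ≡ true → N[ trace X ] w ≡ true
      to h with touches⇒flipAt X (oddOver w) h
      ... | zero  , Xk = ⊆-N (trace X) w (X⇒trace _ w Xk)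
      ... | suc k , Xk with flipAt-∷ʳ k w c
      ...   | inj₁ (k′ , eq) =
        N-intro (trace X) (X⇒trace _ (flipAt k′ w) (subst (λ t → X (_ ∷ t) ≡ true) eq Xk)) (inj₂ (k′ , refl))
      ...   | inj₂ eq        = contradiction (trans (sym (subst (λ t → X (_ ∷ t) ≡ true) eq Xk)) (X-¬c _ w)) λ ()
      from : N[ trace X ] w ≡ true → touches X (oddOver w) ≡ true
      from h with N-elim (trace X) w h
      ... | _ , Xu , inj₁ refl =
        touches-flipAt X zero (oddOver w) (subst (λ y → X (y ∷ (w ∷ʳ c)) ≡ true) (sym (not-involutive _)) Xu)
      ... | _ , Xu , inj₂ (k , refl) =
        touches-flipAt X (suc (inject₁ k)) (oddOver w) (subst (λ v → X v ≡ true) evenOver≡ Xu)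
        where
        evenOver≡ : evenOver (flipAt k w) ≡ flipAt (suc (inject₁ k)) (oddOver w)
        evenOver≡ = trans (cong (λ t → isEven t ∷ t) (sym (flipAt-inject₁-∷ʳ k w c)))
                          (cong (_∷ flipAt (inject₁ k) (w ∷ʳ c)) (isEven-flipAt (inject₁ k) (w ∷ʳ c)))

    card-boundary-trace : card (boundary X ∩ Q) ≡ count N[ trace X ]
    card-boundary-trace = begin
      card (boundary X ∩ Q)                          ≡⟨ card≡count (boundary X ∩ Q) ⟩
      count (boundary X ∩ Q)                         ≡⟨ ∑-select-head (𝟙 ∘ (boundary X ∩ Q)) (not ∘ isEven) off-odd ⟩
      ∑ (λ t → 𝟙 ((boundary X ∩ Q) (oddLift t)))     ≡⟨ ∑-select-last (λ t → 𝟙 ((boundary X ∩ Q) (oddLift t))) c off-layer ⟩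
      ∑ (λ w → 𝟙 ((boundary X ∩ Q) (oddOver w)))     ≡⟨ ∑-cong (cong 𝟙 ∘ on-layer) ⟩
      count N[ trace X ]                             ∎
      where
      open ≡-Reasoning
      oddLift : Vertex (suc m) → Vertex (suc (suc m))
      oddLift t = not (isEven t) ∷ t
      off-odd : ∀ x t → x ≢ not (isEven t) → 𝟙 ((boundary X ∩ Q) (x ∷ t)) ≡ 0
      off-odd x t x≢ = cong (λ b → 𝟙 (b ∧ Q (x ∷ t))) (boundary-even (x ∷ t) x∷t-even)
        where
        x∷t-even : isEven (x ∷ t) ≡ true
        x∷t-even = subst (λ y → isEven (y ∷ t) ≡ true) (sym (trans (¬-not x≢) (not-involutive _))) (isEven-evenLift t)
      off-layer : ∀ w → 𝟙 ((boundary X ∩ Q) (oddLift (w ∷ʳ not c))) ≡ 0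
      off-layer w = cong 𝟙 (trans (cong (boundary X (oddLift (w ∷ʳ not c)) ∧_) (Q-¬c _ w)) (∧-zeroʳ _))
      on-layer : ∀ w → (boundary X ∩ Q) (oddOver w) ≡ N[ trace X ] w
      on-layer w = trans (cong (boundary X (oddOver w) ∧_) (Q-c _ w)) (trans (∧-identityʳ _) (boundary-oddOver w))

  extend : VSet m → VSet (suc (suc m))
  extend Y (x ∷ t) = Q (x ∷ t) ∧ isEven (x ∷ t) ∧ Y (init t)

  module _ (Y : VSet m) where

    extend⊆Q : extend Y ⊆ Q
    extend⊆Q (x ∷ t) h = ∧-conicalˡ (Q (x ∷ t)) _ h

    extend-even : EvenSet (extend Y)
    extend-even (x ∷ t) h = ∧-conicalˡ (isEven (x ∷ t)) (Y (init t)) (∧-conicalʳ (Q (x ∷ t)) _ h)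

    trace-extend : ∀ w → trace (extend Y) w ≡ Y w
    trace-extend w = cong₂ _∧_ (Q-c _ w) (cong₂ _∧_ (isEven-evenLift (w ∷ʳ c)) (cong Y (init-∷ʳ c w)))

    card-extend : card (extend Y) ≡ count Y
    card-extend = trans (card-trace (extend Y) extend⊆Q extend-even) (count-cong trace-extend)

    card-boundary-extend : card (boundary (extend Y) ∩ Q) ≡ count N[ Y ]
    card-boundary-extend =
      trans (card-boundary-trace (extend Y) extend⊆Q extend-even) (count-cong (N-cong trace-extend))

IsMinCost-functional : ∀ {d n v v′} → IsMinCost d n v → IsMinCost d n v′ → v ≡ v′
IsMinCost-functional ((X₁ , X₂ , adm , cost≡v) , v-min) ((X₁′ , X₂′ , adm′ , cost≡v′) , v′-min) =
  ≤-antisym (≤-trans (v-min X₁′ X₂′ adm′) (≤-reflexive cost≡v′)) (≤-trans (v′-min X₁ X₂ adm) (≤-reflexive cost≡v))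

minCost-sequence : ∀ {d} (s t : ℕ → ℕ) → s 0 ≡ t 0 →
  (∀ k → IsMinCost d (s k) (s (suc k))) → (∀ k → IsMinCost d (t k) (t (suc k))) → ∀ k → s k ≡ t k
minCost-sequence s t s0≡t0 s-min t-min zero    = s0≡t0
minCost-sequence {d} s t s0≡t0 s-min t-min (suc k) =
  IsMinCost-functional (subst (λ n → IsMinCost d n (s (suc k))) sk≡tk (s-min k)) (t-min k)
  where
  sk≡tk : s k ≡ t k
  sk≡tk = minCost-sequence s t s0≡t0 s-min t-min k

∅ : VSet m
∅ _ = false

count-∅ : count (∅ {m}) ≡ 0
count-∅ {m} = ∑-zero {m} {𝟙 ∘ ∅} (λ _ → refl)

N-∅ : (w : Vertex m) → N[ ∅ ] w ≡ false
N-∅ w with N[ ∅ ] w in h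
... | false = refl
... | true with N-elim ∅ w h
...   | _ , () , _

module _ (m : ℕ) where
  private
    module L₁ = Layer {m} false inQ₁ (λ x w → cong not (lastC-∷ʳ x w false)) (λ x w → cong not (lastC-∷ʳ x w true))
    module L₂ = Layer {m} true  inQ₂ (λ x w → lastC-∷ʳ x w true) (λ x w → lastC-∷ʳ x w false)

  isMinCost-profile : ∀ {F} → Profile F → ∀ k (Y₁ Y₂ : VSet m) →
    count Y₁ + count Y₂ ≡ F m (suc k) → count N[ Y₁ ] + count N[ Y₂ ] ≡ F m (suc (suc k)) →
    IsMinCost (suc (suc m)) (F m (suc k)) (F m (suc (suc k)))
  isMinCost-profile {F} profile k Y₁ Y₂ size≡ N-size≡ = (X₁ , X₂ , admissible , cost≡) , minimal
    where
    X₁ X₂ : VSet (suc (suc m))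
    X₁ = L₁.extend Y₁
    X₂ = L₂.extend Y₂
    admissible : Admissible (suc (suc m)) (F m (suc k)) X₁ X₂
    admissible = L₁.extend⊆Q Y₁ , L₂.extend⊆Q Y₂ , L₁.extend-even Y₁ , L₂.extend-even Y₂ ,
                 trans (cong₂ _+_ (L₁.card-extend Y₁) (L₂.card-extend Y₂)) size≡
    cost≡ : cost X₁ X₂ ≡ F m (suc (suc k))
    cost≡ = trans (cong₂ _+_ (L₁.card-boundary-extend Y₁) (L₂.card-boundary-extend Y₂)) N-size≡
    minimal : ∀ X₁ X₂ → Admissible (suc (suc m)) (F m (suc k)) X₁ X₂ → F m (suc (suc k)) ≤ cost X₁ X₂
    minimal X₁ X₂ (X₁⊆ , X₂⊆ , even₁ , even₂ , card≡) =
      subst (F m (suc (suc k)) ≤_)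
        (sym (cong₂ _+_ (L₁.card-boundary-trace X₁ X₁⊆ even₁) (L₂.card-boundary-trace X₂ X₂⊆ even₂)))
        (isoperimetric profile m k (L₁.trace X₁) (L₂.trace X₂)
          (≤-reflexive (trans (sym card≡) (cong₂ _+_ (L₁.card-trace X₁ X₁⊆ even₁) (L₂.card-trace X₂ X₂⊆ even₂)))))

  isMinCost-ball : ∀ k → IsMinCost (suc (suc m)) (ballSize m (suc k)) (ballSize m (suc (suc k)))
  isMinCost-ball k = isMinCost-profile ballSize-profile k (ball (suc k)) ∅
    (trans (cong₂ _+_ (count-ball m (suc k)) (count-∅ {m})) (+-identityʳ _))
    (trans (cong₂ _+_ (trans (count-cong (N-ball {m} k)) (count-ball m (suc (suc k))))
                      (trans (count-cong (N-∅ {m})) (count-∅ {m})))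
           (+-identityʳ _))

  isMinCost-cube+ball : ∀ k →
    IsMinCost (suc (suc m)) (2 ^ m + ballSize m (suc k)) (2 ^ m + ballSize m (suc (suc k)))
  isMinCost-cube+ball k = isMinCost-profile (cube+-profile ballSize-profile) k (ball (suc m)) (ball (suc k))
    (cong₂ _+_ (trans (count-ball m (suc m)) (ballSize-full m (suc m) ≤-refl)) (count-ball m (suc k)))
    (cong₂ _+_ (trans (count-cong (N-ball {m} m))
                      (trans (count-ball m (suc (suc m))) (ballSize-full m (suc (suc m)) m<2+m)))
               (trans (count-cong (N-ball {m} k)) (count-ball m (suc (suc k)))))
    where
    m<2+m : m < suc (suc m)
    m<2+m = s≤s (n≤1+n m)

corollary4p4 : (d : ℕ) → 2 ≤ d → (a b : ℕ → ℕ) →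
    a 0 ≡ 1 → b 0 ≡ 2 ^ (d ∸ 2) + 1 →
    (∀ k → IsMinCost d (a k) (a (suc k))) →
    (∀ k → IsMinCost d (b k) (b (suc k))) →
    (a (d ∸ 2) ≡ 2 ^ (d ∸ 2)) × (b (d ∸ 2) ≡ 2 ^ (d ∸ 1))
corollary4p4 (suc (suc m)) (s≤s (s≤s z≤n)) a b a₀ b₀ a-min b-min = a-last , b-last
  where
  a≡ : ∀ k → a k ≡ ballSize m (suc k)
  a≡ = minCost-sequence a _ (trans a₀ (sym (ballSize-1 m))) a-min (isMinCost-ball m)
  b≡ : ∀ k → b k ≡ 2 ^ m + ballSize m (suc k)
  b≡ = minCost-sequence b _ (trans b₀ (cong (2 ^ m +_) (sym (ballSize-1 m)))) b-min (isMinCost-cube+ball m)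
  ball-full : ballSize m (suc m) ≡ 2 ^ m
  ball-full = ballSize-full m (suc m) ≤-refl
  a-last : a m ≡ 2 ^ m
  a-last = trans (a≡ m) ball-full
  b-last : b m ≡ 2 ^ suc m
  b-last = trans (b≡ m) (cong (2 ^ m +_) (trans ball-full (sym (+-identityʳ (2 ^ m)))))
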